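{- Let $G$ be a connected graph with $p$ vertices and $q$ edges such that $e(v_i)>1$ for every vertex $v_i$ of $G$. If the complement $\overline{G}$ is also connected, then $$W_\epsilon(G)+W_\epsilon(\overline{G})\leq\frac12\Big((p-1)\big(\varepsilon^*(G)+\varepsilon^*(\overline{G})\big)-\big(\zeta(G)-\zeta(\overline{G})\big)\Big).$$
   Context: Graphs are finite, simple, undirected. For a connected graph $H$ with vertices $v_1,\ldots,v_p$, $d(v_i,v_j)$ is the distance, $e(v_i)=\max_j d(v_i,v_j)$ the eccentricity, and $\deg(v_i)$ the degree. The eccentricity matrix $\epsilon(H)$ has $(i,j)$ entry $d(v_i,v_j)$ if $d(v_i,v_j)=\min\{e(v_i),e(v_j)\}$ and $0$ otherwise. $W_\epsilon(H)=\frac12\sum_{i,j}(\epsilon(H))_{ij}$; $\varepsilon^*(H)=\sum_i e(v_i)$; $\zeta(H)=\sum_i\deg(v_i)e(v_i)$. $\overline{G}$ is the complement of $G$. -}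

module Defs where

open import Data.Nat using (ℕ; zero; suc; _+_; _*_; _⊔_; _⊓_)
open import Data.Nat.Properties using () renaming (_≟_ to _≟ℕ_)
open import Data.Bool using (Bool; true; false; _∧_; _∨_; not; if_then_else_; T)
open import Data.Fin using (Fin) renaming (_≟_ to _≟F_)
open import Data.List using (List; map; foldr; allFin)
open import Data.Nat.ListAction using (sum)
open import Data.Bool.ListAction using (any)
open import Data.Product using (∃-syntax)
open import Relation.Nullary using (yes; no; ¬_)
open import Relation.Nullary.Decidable using (⌊_⌋)
open import Relation.Binary.PropositionalEquality using (_≡_; refl; sym)

record Graph (p : ℕ) : Set where
  field
    adj    : Fin p → Fin p → Bool
    adjSym : ∀ i j → adj i j ≡ adj j i
    adjIrr : ∀ i → adj i i ≡ false
open Graph public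

complement : ∀ {p} → Graph p → Graph p
complement {p} G = record { adj = a ; adjSym = s ; adjIrr = r }
  where
  a : Fin p → Fin p → Bool
  a i j = if ⌊ i ≟F j ⌋ then false else not (adj G i j)
  s : ∀ i j → a i j ≡ a j i
  s i j with i ≟F j | j ≟F i
  ... | yes _ | yes _ = refl
  ... | yes refl | no n = Data.Empty.⊥-elim (n refl)
    where import Data.Empty
  ... | no n | yes refl = Data.Empty.⊥-elim (n refl)
    where import Data.Empty
  ... | no _ | no _ rewrite adjSym G i j = refl
  r : ∀ i → a i i ≡ false
  r i with i ≟F i
  ... | yes _ = refl
  ... | no n = Data.Empty.⊥-elim (n refl)
    where import Data.Empty

vertices : (p : ℕ) → List (Fin p)
vertices p = allFin p

reach : ∀ {p} → Graph p → ℕ → Fin p → Fin p → Bool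
reach G zero    u v = ⌊ u ≟F v ⌋
reach {p} G (suc k) u v =
  reach G k u v ∨ any (λ w → reach G k u w ∧ adj G w v) (vertices p)

Connected : ∀ {p} → Graph p → Set
Connected {p} G = ∀ (u v : Fin p) → ∃[ k ] T (reach G k u v)

-- least k ≤ n with f k = true (returns n if there is none).
least : (ℕ → Bool) → ℕ → ℕ
least f zero    = zero
least f (suc n) = if f zero then zero else suc (least (λ k → f (suc k)) n)

-- distance d(u,v): length of a shortest walk (meaningful when G is connected,
-- where it is at most p - 1 ≤ p).
dist : ∀ {p} → Graph p → Fin p → Fin p → ℕ
dist {p} G u v = least (λ k → reach G k u v) p

ecc : ∀ {p} → Graph p → Fin p → ℕ
ecc {p} G u = foldr _⊔_ 0 (map (dist G u) (vertices p))

deg : ∀ {p} → Graph p → Fin p → ℕ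
deg {p} G u = sum (map (λ v → if adj G u v then 1 else 0) (vertices p))

eccMat : ∀ {p} → Graph p → Fin p → Fin p → ℕ
eccMat G i j =
  if ⌊ dist G i j ≟ℕ (ecc G i ⊓ ecc G j) ⌋ then dist G i j else 0

twiceWε : ∀ {p} → Graph p → ℕ
twiceWε {p} G = sum (map (λ i → sum (map (eccMat G i) (vertices p))) (vertices p))

totalEcc : ∀ {p} → Graph p → ℕ
totalEcc {p} G = sum (map (ecc G) (vertices p))

zeta : ∀ {p} → Graph p → ℕ
zeta {p} G = sum (map (λ v → deg G v * ecc G v) (vertices p))

{-# OPTIONS --safe #-}
-- In row i of the eccentricity matrix of G the diagonal entry vanishes, and
-- so does the entry of every neighbour v_j of v_i: d(v_i,v_j) = 1 is smaller
-- than min(e(v_i), e(v_j)) > 1.  The remaining p - 1 - deg(v_i) entries are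
-- at most e(v_i), so summing over i gives 2 W_ε(G) ≤ (p - 1) ε*(G) - ζ(G).
-- The same count without the neighbour term gives 2 W_ε(Ḡ) ≤ (p - 1) ε*(Ḡ),
-- and ζ(Ḡ) ≥ 0 closes the gap to the stated bound.
module Submission where

open import Defs
open import Data.Nat using (ℕ; _<_; _∸_)
open import Data.Fin using (Fin)
open import Data.Integer using (+_; _*_; _+_; _-_; _≤_)

open import Data.Bool using (Bool; true; false; T; if_then_else_)
open import Data.Bool.Properties using (T-∨; T-∧; T-≡)
open import Data.Empty using (⊥-elim)
open import Data.Integer using (ℤ; _⊖_; +≤+)
open import Data.Integer.Properties using (⊖-≥; m-n≡m⊖n; pos-*; i≤i+j; +-mono-≤; module ≤-Reasoning)
open import Data.Integer.Tactic.RingSolver using (solve-∀)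
open import Data.List using (List; []; _∷_; map; length)
open import Data.List.Properties using (length-tabulate)
open import Data.List.Membership.Propositional using (_∈_; lose)
open import Data.List.Membership.Propositional.Properties using (∈-allFin)
open import Data.List.Relation.Unary.Any using (here; there)
open import Data.List.Relation.Unary.Any.Properties using (any⁺)
open import Data.Nat.ListAction using (sum)
open import Data.Product using (_,_)
open import Data.Sum using (inj₂)
open import Function using (_∘_; id; Equivalence)
open import Relation.Binary.PropositionalEquality
open import Relation.Nullary using (yes; no)
open import Relation.Nullary.Decidable using (fromWitness)

import Data.Nat as ℕ
import Data.Nat.Properties as ℕ
open import Algebra.Properties.CommutativeSemigroup ℕ.+-commutativeSemigroup
  using () renaming (interchange to +-interchange)

open Equivalence using (from)

module _ {A : Set} where

  sum-map-mono-≤ : ∀ {f g : A → ℕ} (xs : List A) → (∀ x → f x ℕ.≤ g x) →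
                   sum (map f xs) ℕ.≤ sum (map g xs)
  sum-map-mono-≤ []       f≤g = ℕ.z≤n
  sum-map-mono-≤ (x ∷ xs) f≤g = ℕ.+-mono-≤ (f≤g x) (sum-map-mono-≤ xs f≤g)

  sum-map-+ : ∀ (f g : A → ℕ) (xs : List A) →
              sum (map (λ x → f x ℕ.+ g x) xs) ≡ sum (map f xs) ℕ.+ sum (map g xs)
  sum-map-+ f g []       = refl
  sum-map-+ f g (x ∷ xs) =
    trans (cong (f x ℕ.+ g x ℕ.+_) (sum-map-+ f g xs))
          (+-interchange (f x) (g x) _ _)

  sum-map-*ˡ : ∀ (c : ℕ) (f : A → ℕ) (xs : List A) →
               sum (map (λ x → c ℕ.* f x) xs) ≡ c ℕ.* sum (map f xs)
  sum-map-*ˡ c f []       = sym (ℕ.*-zeroʳ c)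
  sum-map-*ˡ c f (x ∷ xs) =
    trans (cong (c ℕ.* f x ℕ.+_) (sum-map-*ˡ c f xs)) (sym (ℕ.*-distribˡ-+ c (f x) _))

  sum-map-*ʳ : ∀ (c : ℕ) (f : A → ℕ) (xs : List A) →
               sum (map (λ x → f x ℕ.* c) xs) ≡ sum (map f xs) ℕ.* c
  sum-map-*ʳ c f []       = refl
  sum-map-*ʳ c f (x ∷ xs) =
    trans (cong (f x ℕ.* c ℕ.+_) (sum-map-*ʳ c f xs)) (sym (ℕ.*-distribʳ-+ c (f x) _))

  sum-map≤length* : ∀ {f : A → ℕ} {c : ℕ} (xs : List A) → (∀ x → f x ℕ.≤ c) →
                            sum (map f xs) ℕ.≤ length xs ℕ.* c
  sum-map≤length* []       f≤c = ℕ.z≤n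
  sum-map≤length* (x ∷ xs) f≤c = ℕ.+-mono-≤ (f≤c x) (sum-map≤length* xs f≤c)

  sum-map+c≤length*c : ∀ {f : A → ℕ} {c : ℕ} {x : A} {xs : List A} →
                               x ∈ xs → f x ≡ 0 → (∀ y → f y ℕ.≤ c) →
                               sum (map f xs) ℕ.+ c ℕ.≤ length xs ℕ.* c
  sum-map+c≤length*c {f} {c} {xs = _ ∷ xs} (here refl) fx≡0 f≤c
    rewrite fx≡0 | ℕ.+-comm (sum (map f xs)) c =
    ℕ.+-monoʳ-≤ c (sum-map≤length* xs f≤c)
  sum-map+c≤length*c {f} {c} {xs = y ∷ xs} (there x∈xs) fx≡0 f≤c
    rewrite ℕ.+-assoc (f y) (sum (map f xs)) c =
    ℕ.+-mono-≤ (f≤c y) (sum-map+c≤length*c x∈xs fx≡0 f≤c)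

m+n≤o*n⇒m≤[o∸1]*n : ∀ m n o → m ℕ.+ n ℕ.≤ o ℕ.* n → m ℕ.≤ (o ∸ 1) ℕ.* n
m+n≤o*n⇒m≤[o∸1]*n m n o m+n≤o*n
  rewrite ℕ.*-distribʳ-∸ n o 1 | ℕ.*-identityˡ n = ℕ.m+n≤o⇒m≤o∸n m m+n≤o*n

m+n≤o⇒+m≤+o-+n : ∀ {m n o} → m ℕ.+ n ℕ.≤ o → + m ≤ + o - + n
m+n≤o⇒+m≤+o-+n {m} {n} {o} m+n≤o = begin
  + m           ≤⟨ +≤+ (ℕ.m+n≤o⇒m≤o∸n m m+n≤o) ⟩
  + (o ∸ n)     ≡⟨ ⊖-≥ (ℕ.≤-trans (ℕ.m≤n+m n m) m+n≤o) ⟨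
  o ⊖ n         ≡⟨ m-n≡m⊖n o n ⟨
  + o - + n     ∎
  where open ≤-Reasoning

least-≤ : ∀ (f : ℕ → Bool) n k → T (f k) → least f n ℕ.≤ k
least-≤ f ℕ.zero    k       fk = ℕ.z≤n
least-≤ f (ℕ.suc n) k       fk with f 0 in f0≡
... | true = ℕ.z≤n
least-≤ f (ℕ.suc n) ℕ.zero    fk | false = ⊥-elim (subst T f0≡ fk)
least-≤ f (ℕ.suc n) (ℕ.suc k) fk | false = ℕ.s≤s (least-≤ (f ∘ ℕ.suc) n k fk)

module _ {p : ℕ} (G : Graph p) where

  reach-refl : ∀ i → T (reach G 0 i i)
  reach-refl i = fromWitness refl

  adj⇒reach-1 : ∀ {i j} → adj G i j ≡ true → T (reach G 1 i j)
  adj⇒reach-1 {i} {j} i~j = from T-∨ (inj₂ (any⁺ _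
    (lose (∈-allFin i) (from T-∧ (reach-refl i , from T-≡ i~j)))))

  dist-refl : ∀ i → dist G i i ≡ 0
  dist-refl i = ℕ.n≤0⇒n≡0 (least-≤ (λ k → reach G k i i) p 0 (reach-refl i))

  adj⇒dist≤1 : ∀ {i j} → adj G i j ≡ true → dist G i j ℕ.≤ 1
  adj⇒dist≤1 {i} {j} i~j = least-≤ (λ k → reach G k i j) p 1 (adj⇒reach-1 i~j)

  eccMat-refl : ∀ i → eccMat G i i ≡ 0
  eccMat-refl i with dist G i i ℕ.≟ ecc G i ℕ.⊓ ecc G i
  ... | yes _ = dist-refl i
  ... | no  _ = refl

  eccMat≤ecc : ∀ i j → eccMat G i j ℕ.≤ ecc G i
  eccMat≤ecc i j with dist G i j ℕ.≟ ecc G i ℕ.⊓ ecc G j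
  ... | yes d≡ = subst (ℕ._≤ ecc G i) (sym d≡) (ℕ.m⊓n≤m (ecc G i) (ecc G j))
  ... | no  _  = ℕ.z≤n

  dist<ecc⊓ecc⇒eccMat≡0 : ∀ {i j} → dist G i j < ecc G i ℕ.⊓ ecc G j → eccMat G i j ≡ 0
  dist<ecc⊓ecc⇒eccMat≡0 {i} {j} d< with dist G i j ℕ.≟ ecc G i ℕ.⊓ ecc G j
  ... | yes d≡ = ⊥-elim (ℕ.<-irrefl d≡ d<)
  ... | no  _  = refl

  eccRow : Fin p → ℕ
  eccRow i = sum (map (eccMat G i) (vertices p))

  length-vertices : length (vertices p) ≡ p
  length-vertices = length-tabulate id

  eccRow≤ : ∀ i → eccRow i ℕ.≤ (p ∸ 1) ℕ.* ecc G i
  eccRow≤ i = m+n≤o*n⇒m≤[o∸1]*n _ _ p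
    (subst (λ n → eccRow i ℕ.+ ecc G i ℕ.≤ n ℕ.* ecc G i) length-vertices
      (sum-map+c≤length*c (∈-allFin i) (eccMat-refl i) (eccMat≤ecc i)))

  eccRow+deg*ecc≤ : (∀ v → 1 < ecc G v) →
                    ∀ i → eccRow i ℕ.+ deg G i ℕ.* ecc G i ℕ.≤ (p ∸ 1) ℕ.* ecc G i
  eccRow+deg*ecc≤ 1<ecc i = m+n≤o*n⇒m≤[o∸1]*n _ _ p
    (subst₂ (λ s n → s ℕ.+ ecc G i ℕ.≤ n ℕ.* ecc G i) weight-sum length-vertices
      (sum-map+c≤length*c (∈-allFin i) weight-refl weight≤ecc))
    where
    indicator : Fin p → ℕ
    indicator j = if adj G i j then 1 else 0

    -- Neighbour entries vanish, so charging e(v_i) to them keeps every weight ≤ e(v_i).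
    weight : Fin p → ℕ
    weight j = eccMat G i j ℕ.+ indicator j ℕ.* ecc G i

    weight-sum : sum (map weight (vertices p)) ≡ eccRow i ℕ.+ deg G i ℕ.* ecc G i
    weight-sum = trans (sum-map-+ (eccMat G i) (λ j → indicator j ℕ.* ecc G i) (vertices p))
                       (cong (eccRow i ℕ.+_) (sum-map-*ʳ (ecc G i) indicator (vertices p)))

    weight-refl : weight i ≡ 0
    weight-refl rewrite eccMat-refl i | adjIrr G i = refl

    weight≤ecc : ∀ j → weight j ℕ.≤ ecc G i
    weight≤ecc j with adj G i j in i~j
    ... | true  rewrite dist<ecc⊓ecc⇒eccMat≡0 (ℕ.≤-<-trans (adj⇒dist≤1 i~j)
                                                          (ℕ.⊓-glb (1<ecc i) (1<ecc j)))
                = ℕ.≤-reflexive (ℕ.+-identityʳ (ecc G i))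
    ... | false rewrite ℕ.+-identityʳ (eccMat G i j) = eccMat≤ecc i j

  twiceWε≤ : twiceWε G ℕ.≤ (p ∸ 1) ℕ.* totalEcc G
  twiceWε≤ = ℕ.≤-trans (sum-map-mono-≤ (vertices p) eccRow≤)
                       (ℕ.≤-reflexive (sum-map-*ˡ (p ∸ 1) (ecc G) (vertices p)))

  twiceWε+zeta≤ : (∀ v → 1 < ecc G v) → twiceWε G ℕ.+ zeta G ℕ.≤ (p ∸ 1) ℕ.* totalEcc G
  twiceWε+zeta≤ 1<ecc = begin
    twiceWε G ℕ.+ zeta G
      ≡⟨ sum-map-+ eccRow (λ i → deg G i ℕ.* ecc G i) (vertices p) ⟨
    sum (map (λ i → eccRow i ℕ.+ deg G i ℕ.* ecc G i) (vertices p))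
      ≤⟨ sum-map-mono-≤ (vertices p) (eccRow+deg*ecc≤ 1<ecc) ⟩
    sum (map (λ i → (p ∸ 1) ℕ.* ecc G i) (vertices p))
      ≡⟨ sum-map-*ˡ (p ∸ 1) (ecc G) (vertices p) ⟩
    (p ∸ 1) ℕ.* totalEcc G ∎
    where open ℕ.≤-Reasoning

theorem4p6 : (p : ℕ) (G : Graph p) →
    Connected G →
    (∀ (v : Fin p) → 1 < ecc G v) →
    Connected (complement G) →
    (+ twiceWε G) + (+ twiceWε (complement G))
      ≤ (+ (p ∸ 1)) * ((+ totalEcc G) + (+ totalEcc (complement G)))
        - ((+ zeta G) - (+ zeta (complement G)))
theorem4p6 p G _ 1<ecc _ = begin
  + twiceWε G + + twiceWε Ḡ
    ≤⟨ +-mono-≤ (m+n≤o⇒+m≤+o-+n (twiceWε+zeta≤ G 1<ecc)) (+≤+ (twiceWε≤ Ḡ)) ⟩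
  + (n ℕ.* e) - + z + + (n ℕ.* ē)
    ≤⟨ i≤i+j _ (+ z̄) ⟩
  + (n ℕ.* e) - + z + + (n ℕ.* ē) + + z̄
    ≡⟨ cong₂ (λ a b → a - + z + b + + z̄) (pos-* n e) (pos-* n ē) ⟩
  + n * + e - + z + + n * + ē + + z̄
    ≡⟨ regroup (+ n) (+ e) (+ ē) (+ z) (+ z̄) ⟩
  + n * (+ e + + ē) - (+ z - + z̄) ∎
  where
  open ≤-Reasoning
  Ḡ = complement G
  n = p ∸ 1
  e = totalEcc G
  ē = totalEcc Ḡ
  z = zeta G
  z̄ = zeta Ḡ
  regroup : ∀ (n e ē z z̄ : ℤ) → n * e - z + n * ē + z̄ ≡ n * (e + ē) - (z - z̄)
  regroup = solve-∀
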